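{- For every $n\ge1$, the set $\mathrm{TSSCPP}(n)$ of totally symmetric self-complementary plane partitions in a $2n\times 2n\times 2n$ box (equivalently, the set of TSSCPP boolean triangles of order $n$) is in weight-preserving bijection with the set of pseudo-Yamanouchi pipe dreams of size $n$ (reduced or not).
   Context: Elements of $\mathrm{TSSCPP}(n)$ are identified, via a standard bijection, with TSSCPP boolean triangles of order $n$: arrays $b=(b_{i,j})$, $1\le i\le n-1$, $n-i\le j\le n-1$, entries in $\{0,1\}$, with $1+\sum_{k=j+1}^{i} b_{k,n-j-1}\ge \sum_{k=j}^{i} b_{k,n-j}$ for all $1\le j<i\le n-1$. Weight: $\mathrm{wt}(b)=\prod_{(i,j):\,b_{i,j}=1}x_{n-i}$. A pipe dream of size $n$ is a tiling of the $n\times n$ grid (rows $1..n$ top to bottom, columns $1..n$ left to right) by cross tiles and elbow tiles, with every position $(i,j)$, $i+j\ge n+1$, an elbow tile; no reducedness is required. Its weight is $\prod x_r$ over cross tiles at $(r,c)$. Reading word: scan rows from bottom to top, within each row left to right; each cross at $(r,c)$ appends $r+c-1$ to a word $\mathbf a=(a_1,\dots,a_\ell)$. Let $\mathrm{cnt}(k,j)$ be the number of occurrences of $j$ among $a_1,\dots,a_k$. The pipe dream is pseudo-Yamanouchi if $1+\mathrm{cnt}(k,j)\ge\mathrm{cnt}(k,j+1)$ for all $1\le k\le \ell$, $1\le j\le n-2$. -}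

module Defs where

open import Data.Bool using (Bool; true; false; _∧_; if_then_else_; T)
open import Data.Nat using (ℕ; zero; suc; _+_; _∸_; _≤ᵇ_; _<ᵇ_; _≡ᵇ_)
open import Data.Bool.ListAction using (all)
open import Data.List using (List; []; _∷_; map; upTo; length; take; concat; reverse)
open import Data.Nat.ListAction using (sum)
open import Data.Vec using (Vec; toList; tabulate)
open import Data.Fin using (Fin; toℕ)
open import Data.Product using (Σ)

range : ℕ → ℕ → List ℕ
range a b = map (a +_) (upTo (suc b ∸ a))

-- 1-based list lookup with default
lookupD : {A : Set} → A → List A → ℕ → A
lookupD d [] _ = d
lookupD d (x ∷ xs) zero = d
lookupD d (x ∷ xs) (suc zero) = x
lookupD d (x ∷ xs) (suc (suc k)) = lookupD d xs (suc k)

-- entry (i , j) of a Boolean matrix, 1-based, false out of range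
entry : {m k : ℕ} → Vec (Vec Bool k) m → ℕ → ℕ → Bool
entry M i j = lookupD false (lookupD [] (map toList (toList M)) i) j

b2n : Bool → ℕ
b2n true = 1
b2n false = 0

-- Monomials in x_1..x_n are represented by exponent vectors:
-- component r (0-based) is the exponent of x_(r+1).
Monomial : ℕ → Set
Monomial n = Vec ℕ n

-- Stored as an (n-1)×(n-1) Boolean array b, 1-based indices (i , j),
-- where only the positions n-i ≤ j ≤ n-1 belong to the triangle;
-- all other positions are required to be false (canonical padding).

TriArray : ℕ → Set
TriArray n = Vec (Vec Bool (n ∸ 1)) (n ∸ 1)

triShapeOK : (n : ℕ) → TriArray n → Bool
triShapeOK n b =
  all (λ i → all (λ j → if (i + j <ᵇ n) then (entry b i j ≡ᵇB false) else true)
                 (range 1 (n ∸ 1)))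
      (range 1 (n ∸ 1))
  where
  _≡ᵇB_ : Bool → Bool → Bool
  true ≡ᵇB true = true
  false ≡ᵇB false = true
  _ ≡ᵇB _ = false

triIneqOK : (n : ℕ) → TriArray n → Bool
triIneqOK n b =
  all (λ i → all (λ j →
         sum (map (λ k → b2n (entry b k (n ∸ j))) (range j i))
           ≤ᵇ suc (sum (map (λ k → b2n (entry b k (n ∸ j ∸ 1))) (range (suc j) i))))
       (range 1 (i ∸ 1)))
      (range 1 (n ∸ 1))

isTSSCPPTri : (n : ℕ) → TriArray n → Bool
isTSSCPPTri n b = triShapeOK n b ∧ triIneqOK n b

TSSCPPTri : ℕ → Set
TSSCPPTri n = Σ (TriArray n) (λ b → T (isTSSCPPTri n b))

-- wt(b) = Π_{b_{i,j} = 1} x_{n-i}; exponent of x_r is Σ_j b_{n-r , j}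
triWeight : (n : ℕ) → TriArray n → Monomial n
triWeight n b = tabulate (λ (f : Fin n) →
  let r = suc (toℕ f) in
  sum (map (λ j → b2n (entry b (n ∸ r) j)) (range 1 (n ∸ 1))))

-- Pipe dreams of size n: n×n Boolean array, true = cross tile,
-- false = elbow tile; rows/columns 1-based.

PDArray : ℕ → Set
PDArray n = Vec (Vec Bool n) n

pdShapeOK : (n : ℕ) → PDArray n → Bool
pdShapeOK n P =
  all (λ i → all (λ j → if (n <ᵇ i + j) then notB (entry P i j) else true)
                 (range 1 n))
      (range 1 n)
  where
  notB : Bool → Bool
  notB true = false
  notB false = true

readingWord : (n : ℕ) → PDArray n → List ℕ
readingWord n P =
  concat (map (λ r → concat (map (λ c → if entry P r c then (r + c ∸ 1) ∷ [] else [])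
                                 (range 1 n)))
              (reverse (range 1 n)))

occ : ℕ → List ℕ → ℕ
occ j w = sum (map (λ a → if a ≡ᵇ j then 1 else 0) w)

isPseudoYamanouchiWord : ℕ → List ℕ → Bool
isPseudoYamanouchiWord n a =
  all (λ k → all (λ j → occ (suc j) (take k a) ≤ᵇ suc (occ j (take k a)))
                 (range 1 (n ∸ 2)))
      (range 1 (length a))

isPYPipeDream : (n : ℕ) → PDArray n → Bool
isPYPipeDream n P = pdShapeOK n P ∧ isPseudoYamanouchiWord n (readingWord n P)

PYPipeDream : ℕ → Set
PYPipeDream n = Σ (PDArray n) (λ P → T (isPYPipeDream n P))

pdWeight : (n : ℕ) → PDArray n → Monomial n
pdWeight n P = tabulate (λ (f : Fin n) →
  let r = suc (toℕ f) in
  sum (map (λ c → b2n (entry P r c)) (range 1 n)))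

-- Write n = N + 1 and let the cross at (r , c) of the pipe dream be the entry b (n - r , r + c - 1)
-- of the triangle.  This re-indexing along anti-diagonals maps the support i + j ≥ n of a
-- triangle onto the support r + c ≤ n of a pipe dream, and row r of the pipe dream carries
-- exactly the ones of row n - r of the triangle, so the bijection preserves weights.  The
-- reading word becomes the concatenation, over i = 1 .. n - 1, of the increasing words
-- { j : b i j = 1 }.  In an increasing block the letter m precedes m + 1, so the
-- pseudo-Yamanouchi inequalities only have to be checked after complete blocks; there they
-- compare the numbers of ones in columns m + 1 and m among the first rows, and since the
-- triangle vanishes above the anti-diagonal this is exactly the TSSCPP inequality.

module Submission where

open import Defs
open import Data.Bool using (Bool; true; false; if_then_else_; T)
open import Data.Bool.Properties using (T-≡; T-∧; T-irrelevant; if-float)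
open import Data.Bool.ListAction using (all)
open import Data.Empty using (⊥-elim)
open import Data.Fin using (toℕ)
open import Data.Fin.Properties using (toℕ<n)
open import Data.List using (List; []; _∷_; _++_; map; upTo; applyUpTo; applyDownFrom; length; take; drop; concat; reverse)
open import Data.List.Properties using (map-upTo; map-∘; map-++; map-id; map-applyUpTo; reverse-applyUpTo; take++drop≡id; take-all; take-[]; ++-assoc; ++-identityʳ; concat-++)
open import Data.List.Relation.Unary.All as All using (All; []; _∷_)
open import Data.List.Relation.Unary.All.Properties using (all⁺; all⁻; applyUpTo⁺₁; applyUpTo⁺₂; applyUpTo⁻; take⁺)
open import Data.List.Relation.Unary.AllPairs using (AllPairs; []; _∷_)
open import Data.Nat
open import Data.Nat.ListAction using (sum)
open import Data.Nat.ListAction.Properties using (sum-++)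
open import Data.Nat.Properties
open import Data.Product using (Σ; _×_; _,_; proj₁; proj₂)
open import Data.Sum using (_⊎_; inj₁; inj₂)
open import Data.Vec using (Vec; toList; tabulate) renaming ([] to []ᵥ; _∷_ to _∷ᵥ_)
open import Data.Vec.Properties using (tabulate-cong)
open import Function.Base using (_∘_)
open import Function.Bundles using (Bijection; _⤖_; Equivalence; _⇔_; mk⇔; mk↔ₛ′)
open import Function.Properties.Inverse using (↔⇒⤖)
open import Relation.Nullary using (¬_; yes; no; contradiction)
open import Relation.Binary.PropositionalEquality using (_≡_; _≢_; refl; sym; trans; cong; cong₂; subst; subst₂; module ≡-Reasoning)

applyUpTo-cong : ∀ {A : Set} {f g : ℕ → A} k → (∀ {x} → x < k → f x ≡ g x) → applyUpTo f k ≡ applyUpTo g k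
applyUpTo-cong zero e = refl
applyUpTo-cong (suc k) e = cong₂ _∷_ (e z<s) (applyUpTo-cong k (e ∘ s<s))

take-applyUpTo : ∀ {A : Set} (f : ℕ → A) t k → take t (applyUpTo f k) ≡ applyUpTo f (t ⊓ k)
take-applyUpTo f zero k = refl
take-applyUpTo f (suc t) zero = refl
take-applyUpTo f (suc t) (suc k) = cong (f 0 ∷_) (take-applyUpTo (f ∘ suc) t k)

range1≡applyUpTo : ∀ b → range 1 b ≡ applyUpTo suc b
range1≡applyUpTo = map-upTo suc

map-range1 : ∀ {A : Set} (f : ℕ → A) b → map f (range 1 b) ≡ applyUpTo (f ∘ suc) b
map-range1 f b = trans (cong (map f) (range1≡applyUpTo b)) (map-applyUpTo suc f b)

all-range1⁺ : ∀ (p : ℕ → Bool) b → T (all p (range 1 b)) → ∀ {x} → x < b → T (p (suc x))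
all-range1⁺ p b t = applyUpTo⁻ suc b (all⁺ p _ (subst (T ∘ all p) (range1≡applyUpTo b) t))

all-range1⁻ : ∀ (p : ℕ → Bool) b → (∀ {x} → x < b → T (p (suc x))) → T (all p (range 1 b))
all-range1⁻ p b h = subst (T ∘ all p) (sym (range1≡applyUpTo b)) (all⁻ p (applyUpTo⁺₁ suc b h))

all-range1-counterexample : ∀ (p : ℕ → Bool) b → all p (range 1 b) ≡ false → Σ ℕ λ x → x < b × p (suc x) ≡ false
all-range1-counterexample p b fails = counterexample suc b (trans (cong (all p) (sym (range1≡applyUpTo b))) fails)
  where
  counterexample : ∀ (h : ℕ → ℕ) k → all p (applyUpTo h k) ≡ false → Σ ℕ λ x → x < k × p (h x) ≡ false
  counterexample h (suc k) fails with p (h 0) in eq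
  ... | false = 0 , z<s , eq
  ... | true with counterexample (h ∘ suc) k fails
  ...   | x , x<k , px = suc x , s<s x<k , px

reverse-range1 : ∀ n → reverse (range 1 n) ≡ applyUpTo (n ∸_) n
reverse-range1 n = trans (cong reverse (range1≡applyUpTo n)) (trans (reverse-applyUpTo suc n) (downFrom n))
  where
  downFrom : ∀ n → applyDownFrom suc n ≡ applyUpTo (n ∸_) n
  downFrom zero = refl
  downFrom (suc n) = cong (suc n ∷_) (downFrom n)

sumUpTo : (ℕ → ℕ) → ℕ → ℕ
sumUpTo f k = sum (applyUpTo f k)

sumUpTo-cong : ∀ {f g} k → (∀ {x} → x < k → f x ≡ g x) → sumUpTo f k ≡ sumUpTo g k
sumUpTo-cong k e = cong sum (applyUpTo-cong k e)

sumUpTo-+ : ∀ f a k → sumUpTo f (a + k) ≡ sumUpTo f a + sumUpTo (λ y → f (a + y)) k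
sumUpTo-+ f zero k = refl
sumUpTo-+ f (suc a) k = trans (cong (f 0 +_) (sumUpTo-+ (f ∘ suc) a k)) (sym (+-assoc (f 0) _ _))

sumUpTo-zero : ∀ f k → (∀ {x} → x < k → f x ≡ 0) → sumUpTo f k ≡ 0
sumUpTo-zero f zero e = refl
sumUpTo-zero f (suc k) e = cong₂ _+_ (e z<s) (sumUpTo-zero (f ∘ suc) k (e ∘ s<s))

sumUpTo-suc : ∀ f k → sumUpTo f (suc k) ≡ sumUpTo f k + f k
sumUpTo-suc f zero = +-comm (f 0) 0
sumUpTo-suc f (suc k) = trans (cong (f 0 +_) (sumUpTo-suc (f ∘ suc) k)) (sym (+-assoc (f 0) _ _))

sumUpTo-single : ∀ f k {x₀} → x₀ < k → (∀ {x} → x < k → x ≢ x₀ → f x ≡ 0) → sumUpTo f k ≡ f x₀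
sumUpTo-single f (suc k) {zero} _ e =
  trans (cong (f 0 +_) (sumUpTo-zero (f ∘ suc) k (λ x<k → e (s<s x<k) λ ())) ) (+-identityʳ (f 0))
sumUpTo-single f (suc k) {suc x₀} (s<s x₀<k) e =
  cong₂ _+_ (e z<s λ ()) (sumUpTo-single (f ∘ suc) k x₀<k (λ x<k x≢x₀ → e (s<s x<k) (x≢x₀ ∘ suc-injective)))

sumUpTo-dropZeros : ∀ f {a t} → a ≤ t → (∀ {x} → x < a → f x ≡ 0) → sumUpTo (λ y → f (a + y)) (t ∸ a) ≡ sumUpTo f t
sumUpTo-dropZeros f {a} {t} a≤t z = begin
  sumUpTo (λ y → f (a + y)) (t ∸ a)                   ≡⟨ cong (_+ sumUpTo (λ y → f (a + y)) (t ∸ a)) (sumUpTo-zero f a z) ⟨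
  sumUpTo f a + sumUpTo (λ y → f (a + y)) (t ∸ a)     ≡⟨ sumUpTo-+ f a (t ∸ a) ⟨
  sumUpTo f (a + (t ∸ a))                             ≡⟨ cong (sumUpTo f) (m+[n∸m]≡n a≤t) ⟩
  sumUpTo f t                                         ∎
  where open ≡-Reasoning

sum-map-range : ∀ (f : ℕ → ℕ) a b → sum (map f (range a b)) ≡ sumUpTo (λ y → f (a + y)) (suc b ∸ a)
sum-map-range f a b = cong sum (trans (sym (map-∘ (upTo (suc b ∸ a)))) (map-upTo (λ y → f (a + y)) (suc b ∸ a)))

take-++ˡ : ∀ {A : Set} k (u w : List A) → k ≤ length u → take k (u ++ w) ≡ take k u
take-++ˡ zero u w _ = refl
take-++ˡ (suc k) (x ∷ u) w (s≤s k≤) = cong (x ∷_) (take-++ˡ k u w k≤)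

take-++ʳ : ∀ {A : Set} k (u w : List A) → take (length u + k) (u ++ w) ≡ u ++ take k w
take-++ʳ k [] w = refl
take-++ʳ k (x ∷ u) w = cong (x ∷_) (take-++ʳ k u w)

take-length-++ : ∀ {A : Set} (u w : List A) → take (length u) (u ++ w) ≡ u
take-length-++ u w = begin
  take (length u) (u ++ w)        ≡⟨ cong (λ k → take k (u ++ w)) (+-identityʳ (length u)) ⟨
  take (length u + 0) (u ++ w)    ≡⟨ take-++ʳ 0 u w ⟩
  u ++ []                         ≡⟨ ++-identityʳ u ⟩
  u                               ∎
  where open ≡-Reasoning

-- Letter counts on prefixes of concatenated increasing words

occ-++ : ∀ j (u w : List ℕ) → occ j (u ++ w) ≡ occ j u + occ j w
occ-++ j u w = trans (cong sum (map-++ _ u w)) (sum-++ (map _ u) (map _ w))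

occ-concat : ∀ j (h : ℕ → List ℕ) t → occ j (concat (applyUpTo h t)) ≡ sumUpTo (λ i → occ j (h i)) t
occ-concat j h zero = refl
occ-concat j h (suc t) = trans (occ-++ j (h 0) _) (cong (occ j (h 0) +_) (occ-concat j (h ∘ suc) t))

≡ᵇ-false : ∀ {a j} → a ≢ j → (a ≡ᵇ j) ≡ false
≡ᵇ-false {a} {j} a≢j with a ≡ᵇ j in eq
... | true = ⊥-elim (a≢j (≡ᵇ⇒≡ a j (Equivalence.from T-≡ eq)))
... | false = refl

occ-below : ∀ {j} (w : List ℕ) → All (j <_) w → occ j w ≡ 0
occ-below [] [] = refl
occ-below {j} (a ∷ w) (j<a ∷ j<w) rewrite ≡ᵇ-false {a} {j} (>⇒≢ j<a) = occ-below w j<w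

PYAt : ℕ → List ℕ → Set
PYAt m w = occ (suc m) w ≤ suc (occ m w)

SameCounts : ℕ → List ℕ → List ℕ → Set
SameCounts m u v = occ m u ≡ occ m v × occ (suc m) u ≡ occ (suc m) v

-- In an increasing word an occurrence of m, if any, precedes that of suc m.
increasing-prefix-counts : ∀ m (u : List ℕ) → AllPairs _<_ u → ∀ k →
  occ (suc m) (take k u) ≡ 0 ⊎ SameCounts m (take k u) u
increasing-prefix-counts m u inc zero = inj₁ refl
increasing-prefix-counts m [] inc (suc k) = inj₁ refl
increasing-prefix-counts m (x ∷ u) (x<u ∷ inc) (suc k) with x ≟ suc m
... | yes refl = inj₂ (cong (_ +_) (trans (occ-below _ (take⁺ k x<m)) (sym (occ-below u x<m))) ,
                       cong (_ +_) (trans (occ-below _ (take⁺ k x<u)) (sym (occ-below u x<u))))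
  where
  x<m : All (m <_) u
  x<m = All.map (<-trans (n<1+n m)) x<u
... | no x≢sm with increasing-prefix-counts m u inc k
...   | inj₁ none = inj₁ (cong₂ _+_ (cong (λ b → if b then 1 else 0) (≡ᵇ-false x≢sm)) none)
...   | inj₂ (same , sameₛ) = inj₂ (cong (_ +_) same , cong (_ +_) sameₛ)

PYAt-extend-zero : ∀ m p v → occ (suc m) v ≡ 0 → PYAt m p → PYAt m (p ++ v)
PYAt-extend-zero m p v none py = begin
  occ (suc m) (p ++ v)            ≡⟨ occ-++ (suc m) p v ⟩
  occ (suc m) p + occ (suc m) v   ≡⟨ cong (occ (suc m) p +_) none ⟩
  occ (suc m) p + 0               ≡⟨ +-identityʳ _ ⟩
  occ (suc m) p                   ≤⟨ py ⟩
  suc (occ m p)                   ≤⟨ s≤s (m≤m+n (occ m p) (occ m v)) ⟩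
  suc (occ m p + occ m v)         ≡⟨ cong suc (occ-++ m p v) ⟨
  suc (occ m (p ++ v))            ∎
  where open ≤-Reasoning

PYAt-extend-same : ∀ m p u v → SameCounts m u v → PYAt m (p ++ v) → PYAt m (p ++ u)
PYAt-extend-same m p u v (same , sameₛ) =
  subst₂ (λ a b → a ≤ suc b)
    (trans (occ-++ (suc m) p v) (trans (cong (_ +_) (sym sameₛ)) (sym (occ-++ (suc m) p u))))
    (trans (occ-++ m p v) (trans (cong (_ +_) (sym same)) (sym (occ-++ m p u))))

blockPY⇒prefixPY : ∀ m p (L : List (List ℕ)) → All (AllPairs _<_) L →
  (∀ t → PYAt m (p ++ concat (take t L))) → ∀ k → PYAt m (p ++ take k (concat L))
blockPY⇒prefixPY m p [] _ hyp k = subst (λ w → PYAt m (p ++ w)) (sym (take-[] k)) (hyp 0)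
blockPY⇒prefixPY m p (u ∷ L) (inc ∷ incs) hyp k with k ≤? length u
... | yes k≤u = subst (λ w → PYAt m (p ++ w)) (sym (take-++ˡ k u (concat L) k≤u)) inBlock
  where
  inBlock : PYAt m (p ++ take k u)
  inBlock with increasing-prefix-counts m u inc k
  ... | inj₁ none = PYAt-extend-zero m p (take k u) none (subst (PYAt m) (++-identityʳ p) (hyp 0))
  ... | inj₂ same = PYAt-extend-same m p (take k u) u same (subst (λ w → PYAt m (p ++ w)) (++-identityʳ u) (hyp 1))
... | no k≰u = subst (λ i → PYAt m (p ++ take i (u ++ concat L))) (m+[n∸m]≡n (<⇒≤ (≰⇒> k≰u))) afterBlock
  where
  k′ : ℕ
  k′ = k ∸ length u
  afterBlock : PYAt m (p ++ take (length u + k′) (u ++ concat L))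
  afterBlock = subst (PYAt m) (trans (++-assoc p u _) (cong (p ++_) (sym (take-++ʳ k′ u (concat L)))))
    (blockPY⇒prefixPY m (p ++ u) L incs (λ t → subst (PYAt m) (sym (++-assoc p u _)) (hyp (suc t))) k′)

prefixPY⇒blockPY : ∀ m (L : List (List ℕ)) → (∀ k → PYAt m (take k (concat L))) → ∀ t → PYAt m (concat (take t L))
prefixPY⇒blockPY m L hyp t = subst (PYAt m) isPrefix (hyp (length (concat (take t L))))
  where
  ℓ : ℕ
  ℓ = length (concat (take t L))
  isPrefix : take ℓ (concat L) ≡ concat (take t L)
  isPrefix = begin
    take ℓ (concat L)                                       ≡⟨ cong (take ℓ ∘ concat) (take++drop≡id t L) ⟨
    take ℓ (concat (take t L ++ drop t L))                  ≡⟨ cong (take ℓ) (concat-++ (take t L) (drop t L)) ⟨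
    take ℓ (concat (take t L) ++ concat (drop t L))         ≡⟨ take-length-++ _ _ ⟩
    concat (take t L)                                       ∎
    where open ≡-Reasoning

matrix : (ℕ → ℕ → Bool) → (m k : ℕ) → Vec (Vec Bool k) m
matrix G m k = tabulate (λ r → tabulate (λ c → G (suc (toℕ r)) (suc (toℕ c))))

lookupD-map-tabulate : ∀ {A B : Set} (d : B) (φ : A → B) n (h : ℕ → A) {x} → x < n →
  lookupD d (map φ (toList (tabulate {n = n} (h ∘ toℕ)))) (suc x) ≡ φ (h x)
lookupD-map-tabulate d φ (suc n) h {zero} _ = refl
lookupD-map-tabulate d φ (suc n) h {suc x} (s<s x<n) = lookupD-map-tabulate d φ n (h ∘ suc) x<n

lookupD-tabulate : ∀ {A : Set} (d : A) n (h : ℕ → A) {x} → x < n →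
  lookupD d (toList (tabulate {n = n} (h ∘ toℕ))) (suc x) ≡ h x
lookupD-tabulate d n h x<n =
  trans (cong (λ l → lookupD d l _) (sym (map-id (toList (tabulate {n = n} (h ∘ toℕ))))))
        (lookupD-map-tabulate d (λ a → a) n h x<n)

entry-matrix : ∀ G {m k x y} → x < m → y < k → entry (matrix G m k) (suc x) (suc y) ≡ G (suc x) (suc y)
entry-matrix G {m} {k} {x} {y} x<m y<k =
  trans (cong (λ row → lookupD false row (suc y))
          (lookupD-map-tabulate [] toList m (λ r → tabulate {n = k} (λ c → G (suc r) (suc (toℕ c)))) x<m))
        (lookupD-tabulate false k (λ c → G (suc x) (suc c)) y<k)

entry-row0 : ∀ {m k} (M : Vec (Vec Bool k) m) j → entry M 0 j ≡ false
entry-row0 {zero} []ᵥ j = refl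
entry-row0 {suc m} (r ∷ᵥ M) j = refl

entry-col0 : ∀ {m k} (M : Vec (Vec Bool k) m) i → entry M i 0 ≡ false
entry-col0 M i with lookupD [] (map toList (toList M)) i
... | [] = refl
... | _ ∷ _ = refl

row-ext : ∀ {k} (r r′ : Vec Bool k) →
  (∀ {y} → y < k → lookupD false (toList r) (suc y) ≡ lookupD false (toList r′) (suc y)) → r ≡ r′
row-ext []ᵥ []ᵥ e = refl
row-ext (a ∷ᵥ r) (a′ ∷ᵥ r′) e = cong₂ _∷ᵥ_ (e z<s) (row-ext r r′ (e ∘ s<s))

entry-ext : ∀ {m k} (M M′ : Vec (Vec Bool k) m) →
  (∀ {x y} → x < m → y < k → entry M (suc x) (suc y) ≡ entry M′ (suc x) (suc y)) → M ≡ M′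
entry-ext []ᵥ []ᵥ e = refl
entry-ext (r ∷ᵥ M) (r′ ∷ᵥ M′) e = cong₂ _∷ᵥ_ (row-ext r r′ (e z<s)) (entry-ext M M′ (e ∘ s<s))

-- Re-indexing triangles as pipe dreams

≤ᵇ-true : ∀ {a c} → a ≤ c → (a ≤ᵇ c) ≡ true
≤ᵇ-true a≤c = Equivalence.to T-≡ (≤⇒≤ᵇ a≤c)

≤ᵇ-false : ∀ {a c} → ¬ a ≤ c → (a ≤ᵇ c) ≡ false
≤ᵇ-false {a} {c} a≰c with a ≤ᵇ c in eq
... | true = ⊥-elim (a≰c (≤ᵇ⇒≤ a c (Equivalence.from T-≡ eq)))
... | false = refl

pipeDreamCell : (N : ℕ) → TriArray (suc N) → ℕ → ℕ → Bool
pipeDreamCell N b r c = if r + c ≤ᵇ suc N then entry b (suc N ∸ r) (r + c ∸ 1) else false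

triangleCell : (N : ℕ) → PDArray (suc N) → ℕ → ℕ → Bool
triangleCell N P i j = if suc N ≤ᵇ i + j then entry P (suc N ∸ i) (suc (i + j) ∸ suc N) else false

toPipeDream : (N : ℕ) → TriArray (suc N) → PDArray (suc N)
toPipeDream N b = matrix (pipeDreamCell N b) (suc N) (suc N)

toTriangle : (N : ℕ) → PDArray (suc N) → TriArray (suc N)
toTriangle N P = matrix (triangleCell N P) N N

record Corresponding (N r c i j : ℕ) : Set where
  constructor corresponding
  field
    rows : r + i ≡ suc N
    diagonal : r + c ≡ suc j

pipeDreamCell-corr : ∀ {N} b {r c i j} → Corresponding N r c i j → j ≤ N → pipeDreamCell N b r c ≡ entry b i j
pipeDreamCell-corr {N} b {r} {c} {i} (corresponding r+i r+c) j≤N rewrite r+c | ≤ᵇ-true (s≤s j≤N) =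
  cong (λ k → entry b k _) (trans (cong (_∸ r) (sym r+i)) (m+n∸m≡n r i))

corresponding-sum : ∀ {N r c i j} → Corresponding N r (suc c) i j → i + j ≡ suc N + c
corresponding-sum {N} {r} {c} {i} {j} (corresponding r+i r+c) = begin
  i + j         ≡⟨ cong (i +_) (suc-injective (trans (sym (+-suc r c)) r+c)) ⟨
  i + (r + c)   ≡⟨ +-assoc i r c ⟨
  i + r + c     ≡⟨ cong (_+ c) (trans (+-comm i r) r+i) ⟩
  suc N + c     ∎
  where open ≡-Reasoning

triangleCell-corr : ∀ {N} P {r c i j} → Corresponding N r (suc c) i j → triangleCell N P i j ≡ entry P r (suc c)
triangleCell-corr {N} P {r} {c} {i} corr@(corresponding r+i _) rewrite corresponding-sum corr | ≤ᵇ-true (m≤m+n (suc N) c) =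
  cong₂ (entry P) (trans (cong (_∸ i) (sym r+i)) (m+n∸n≡m r i))
                  (trans (cong (_∸ N) (sym (+-suc N c))) (m+n∸m≡n N (suc c)))

pipeDreamCell-outside : ∀ {N} b r c → ¬ r + c ≤ suc N → pipeDreamCell N b r c ≡ false
pipeDreamCell-outside b r c r+c≰ rewrite ≤ᵇ-false r+c≰ = refl

triangleCell-outside : ∀ {N} P i j → ¬ suc N ≤ i + j → triangleCell N P i j ≡ false
triangleCell-outside P i j ≰i+j rewrite ≤ᵇ-false ≰i+j = refl

pipeDreamPosition : ∀ {N x y} → x < N → y < N → suc N ≤ suc x + suc y →
  Σ ℕ λ r → Σ ℕ λ c → r < suc N × c < suc N × Corresponding N (suc r) (suc c) (suc x) (suc y)
pipeDreamPosition {N} {x} {y} x<N y<N inside = r , c , s≤s (m∸n≤m N (suc x)) , s≤s (≤-trans (m∸n≤m y r) (<⇒≤ y<N)) ,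
  corresponding (cong suc (m∸n+n≡m x<N)) (cong suc (trans (+-suc r c) (cong suc (m+[n∸m]≡n r≤y))))
  where
  r : ℕ
  r = N ∸ suc x
  c : ℕ
  c = y ∸ r
  r≤y : r ≤ y
  r≤y = ≤-pred (+-cancelʳ-< (suc x) r (suc y) (begin-strict
    r + suc x       ≡⟨ m∸n+n≡m x<N ⟩
    N               <⟨ inside ⟩
    suc x + suc y   ≡⟨ +-comm (suc x) (suc y) ⟩
    suc y + suc x   ∎))
    where open ≤-Reasoning

trianglePosition : ∀ {N x y} → suc x + suc y ≤ suc N →
  Σ ℕ λ i → Σ ℕ λ j → i < N × j < N × Corresponding N (suc x) (suc y) (suc i) (suc j)
trianglePosition {N} {x} {y} inside = N ∸ suc x , x + y , i<N , j<N ,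
  corresponding (cong suc (trans (+-comm x (suc (N ∸ suc x))) (trans (sym (+-suc (N ∸ suc x) x)) (m∸n+n≡m sx≤N))))
                (cong suc (+-suc x y))
  where
  j<N : x + y < N
  j<N = subst (_≤ N) (+-suc x y) (≤-pred inside)
  sx≤N : suc x ≤ N
  sx≤N = ≤-trans (s≤s (m≤m+n x y)) j<N
  i<N : N ∸ suc x < N
  i<N = ∸-monoʳ-< z<s sx≤N

TriShaped : (N : ℕ) → TriArray (suc N) → Set
TriShaped N b = ∀ i j → i + j ≤ N → entry b i j ≡ false

PDShaped : (N : ℕ) → PDArray (suc N) → Set
PDShaped N P = ∀ {x y} → x < suc N → y < suc N → suc N < suc x + suc y → entry P (suc x) (suc y) ≡ false

toTriangle∘toPipeDream : ∀ N b → TriShaped N b → toTriangle N (toPipeDream N b) ≡ b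
toTriangle∘toPipeDream N b shaped = entry-ext _ b cell
  where
  cell : ∀ {x y} → x < N → y < N → entry (toTriangle N (toPipeDream N b)) (suc x) (suc y) ≡ entry b (suc x) (suc y)
  cell {x} {y} x<N y<N with suc N ≤? suc x + suc y
  ... | no outside = begin
    entry (toTriangle N (toPipeDream N b)) (suc x) (suc y)  ≡⟨ entry-matrix (triangleCell N (toPipeDream N b)) x<N y<N ⟩
    triangleCell N (toPipeDream N b) (suc x) (suc y)        ≡⟨ triangleCell-outside (toPipeDream N b) (suc x) (suc y) outside ⟩
    false                                                   ≡⟨ shaped (suc x) (suc y) (≤-pred (≰⇒> outside)) ⟨
    entry b (suc x) (suc y)                                 ∎
    where open ≡-Reasoning
  ... | yes inside with pipeDreamPosition x<N y<N inside
  ...   | r , c , r<n , c<n , corr = begin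
    entry (toTriangle N (toPipeDream N b)) (suc x) (suc y)  ≡⟨ entry-matrix (triangleCell N (toPipeDream N b)) x<N y<N ⟩
    triangleCell N (toPipeDream N b) (suc x) (suc y)        ≡⟨ triangleCell-corr (toPipeDream N b) corr ⟩
    entry (toPipeDream N b) (suc r) (suc c)                 ≡⟨ entry-matrix (pipeDreamCell N b) r<n c<n ⟩
    pipeDreamCell N b (suc r) (suc c)                       ≡⟨ pipeDreamCell-corr b corr y<N ⟩
    entry b (suc x) (suc y)                                 ∎
    where open ≡-Reasoning

toPipeDream∘toTriangle : ∀ N P → PDShaped N P → toPipeDream N (toTriangle N P) ≡ P
toPipeDream∘toTriangle N P shaped = entry-ext _ P cell
  where
  cell : ∀ {x y} → x < suc N → y < suc N → entry (toPipeDream N (toTriangle N P)) (suc x) (suc y) ≡ entry P (suc x) (suc y)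
  cell {x} {y} x<n y<n with suc x + suc y ≤? suc N
  ... | no outside = begin
    entry (toPipeDream N (toTriangle N P)) (suc x) (suc y)  ≡⟨ entry-matrix (pipeDreamCell N (toTriangle N P)) x<n y<n ⟩
    pipeDreamCell N (toTriangle N P) (suc x) (suc y)        ≡⟨ pipeDreamCell-outside (toTriangle N P) (suc x) (suc y) outside ⟩
    false                                                   ≡⟨ shaped x<n y<n (≰⇒> outside) ⟨
    entry P (suc x) (suc y)                                 ∎
    where open ≡-Reasoning
  ... | yes inside with trianglePosition inside
  ...   | i , j , i<N , j<N , corr = begin
    entry (toPipeDream N (toTriangle N P)) (suc x) (suc y)  ≡⟨ entry-matrix (pipeDreamCell N (toTriangle N P)) x<n y<n ⟩
    pipeDreamCell N (toTriangle N P) (suc x) (suc y)        ≡⟨ pipeDreamCell-corr (toTriangle N P) corr j<N ⟩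
    entry (toTriangle N P) (suc i) (suc j)                  ≡⟨ entry-matrix (triangleCell N P) i<N j<N ⟩
    triangleCell N P (suc i) (suc j)                        ≡⟨ triangleCell-corr P corr ⟩
    entry P (suc x) (suc y)                                 ∎
    where open ≡-Reasoning

toPipeDream-shaped : ∀ N b → PDShaped N (toPipeDream N b)
toPipeDream-shaped N b {x} {y} x<n y<n outside = trans (entry-matrix (pipeDreamCell N b) x<n y<n) (pipeDreamCell-outside b (suc x) (suc y) (<⇒≱ outside))

toTriangle-shaped : ∀ N P → TriShaped N (toTriangle N P)
toTriangle-shaped N P zero j _ = entry-row0 (toTriangle N P) j
toTriangle-shaped N P (suc i) zero _ = entry-col0 (toTriangle N P) (suc i)
toTriangle-shaped N P (suc i) (suc j) i+j≤N =
  trans (entry-matrix (triangleCell N P) (≤-trans (s≤s (m≤m+n i (suc j))) i+j≤N) (≤-trans (m≤n+m (suc j) (suc i)) i+j≤N))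
        (triangleCell-outside P (suc i) (suc j) (<⇒≱ (s≤s i+j≤N)))

triShapeOK⇒TriShaped : ∀ N b → T (triShapeOK (suc N) b) → TriShaped N b
triShapeOK⇒TriShaped N b ok zero j _ = entry-row0 b j
triShapeOK⇒TriShaped N b ok (suc i) zero _ = entry-col0 b (suc i)
triShapeOK⇒TriShaped N b ok (suc i) (suc j) i+j≤N
  with all-range1⁺ _ N (all-range1⁺ _ N ok (≤-trans (s≤s (m≤m+n i (suc j))) i+j≤N)) (≤-trans (m≤n+m (suc j) (suc i)) i+j≤N)
... | cell with suc i + suc j <ᵇ suc N | <⇒<ᵇ (s≤s i+j≤N) | entry b (suc i) (suc j)
...   | true | _ | false = refl

TriShaped⇒triShapeOK : ∀ N b → TriShaped N b → T (triShapeOK (suc N) b)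
TriShaped⇒triShapeOK N b shaped with triShapeOK (suc N) b in ok
... | true = _
... | false with all-range1-counterexample _ N ok
...   | x , _ , row with all-range1-counterexample _ N row
...     | y , _ , cell with suc x + suc y <ᵇ suc N in inside | entry b (suc x) (suc y) in e
...       | true | true = contradiction (trans (sym e) (shaped (suc x) (suc y) (≤-pred (<ᵇ⇒< _ _ (Equivalence.from T-≡ inside))))) λ ()

pdShapeOK⇒PDShaped : ∀ N P → T (pdShapeOK (suc N) P) → PDShaped N P
pdShapeOK⇒PDShaped N P ok {x} {y} x<n y<n outside with all-range1⁺ _ (suc N) (all-range1⁺ _ (suc N) ok x<n) y<n
... | cell with suc N <ᵇ suc x + suc y | <⇒<ᵇ outside | entry P (suc x) (suc y)
...   | true | _ | false = refl

PDShaped⇒pdShapeOK : ∀ N P → PDShaped N P → T (pdShapeOK (suc N) P)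
PDShaped⇒pdShapeOK N P shaped with pdShapeOK (suc N) P in ok
... | true = _
... | false with all-range1-counterexample _ (suc N) ok
...   | x , x<n , row with all-range1-counterexample _ (suc N) row
...     | y , y<n , cell with suc N <ᵇ suc x + suc y in outside | entry P (suc x) (suc y) in e
...       | true | true = contradiction (trans (sym e) (shaped x<n y<n (<ᵇ⇒< _ _ (Equivalence.from T-≡ outside)))) λ ()

select : (ℕ → Bool) → (ℕ → ℕ) → ℕ → List ℕ
select p q k = concat (applyUpTo (λ x → if p x then q x ∷ [] else []) k)

select-cong : ∀ {p p′ q q′} k → (∀ {x} → x < k → p x ≡ p′ x) → (∀ {x} → x < k → q x ≡ q′ x) → select p q k ≡ select p′ q′ k
select-cong k p≡ q≡ = cong concat (applyUpTo-cong k (λ x<k → cong₂ (λ b a → if b then a ∷ [] else []) (p≡ x<k) (q≡ x<k)))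

select-all : ∀ {P : ℕ → Set} p q k → (∀ x → P (q x)) → All P (select p q k)
select-all p q zero _ = []
select-all p q (suc k) Pq with p 0
... | true = Pq 0 ∷ select-all (p ∘ suc) (q ∘ suc) k (Pq ∘ suc)
... | false = select-all (p ∘ suc) (q ∘ suc) k (Pq ∘ suc)

select-increasing : ∀ p q k → (∀ {x y} → x < y → q x < q y) → AllPairs _<_ (select p q k)
select-increasing p q zero _ = []
select-increasing p q (suc k) q< with p 0
... | true = select-all (p ∘ suc) (q ∘ suc) k (λ _ → q< z<s) ∷ select-increasing (p ∘ suc) (q ∘ suc) k (q< ∘ s<s)
... | false = select-increasing (p ∘ suc) (q ∘ suc) k (q< ∘ s<s)

occ-select : ∀ m p q k → occ m (select p q k) ≡ sumUpTo (λ x → if p x then occ m (q x ∷ []) else 0) k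
occ-select m p q k = trans (occ-concat m _ k) (sumUpTo-cong k λ {x} _ → if-float (occ m) (p x))

occ-singleton-≢ : ∀ {a m} → a ≢ m → occ m (a ∷ []) ≡ 0
occ-singleton-≢ a≢m rewrite ≡ᵇ-false a≢m = refl

occ-select-hit : ∀ m p q k {x₀} → x₀ < k → q x₀ ≡ m → (∀ {x} → q x ≡ m → x ≡ x₀) → occ m (select p q k) ≡ b2n (p x₀)
occ-select-hit m p q k {x₀} x₀<k qx₀ unique = trans (occ-select m p q k) (trans (sumUpTo-single _ k x₀<k others) hit)
  where
  others : ∀ {x} → x < k → x ≢ x₀ → (if p x then occ m (q x ∷ []) else 0) ≡ 0
  others {x} _ x≢x₀ with p x
  ... | true = occ-singleton-≢ (x≢x₀ ∘ unique)
  ... | false = refl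
  hit : (if p x₀ then occ m (q x₀ ∷ []) else 0) ≡ b2n (p x₀)
  hit rewrite qx₀ | Equivalence.to T-≡ (≡⇒≡ᵇ m m refl) with p x₀
  ... | true = refl
  ... | false = refl

occ-select-miss : ∀ m p q k → (∀ x → q x ≢ m) → occ m (select p q k) ≡ 0
occ-select-miss m p q k miss = trans (occ-select m p q k) (sumUpTo-zero _ k λ {x} _ → absent x)
  where
  absent : ∀ x → (if p x then occ m (q x ∷ []) else 0) ≡ 0
  absent x with p x
  ... | true = occ-singleton-≢ (miss x)
  ... | false = refl

rowWord : (n : ℕ) → PDArray n → ℕ → List ℕ
rowWord n P r = select (λ x → entry P r (suc x)) (λ x → r + suc x ∸ 1) n

readingWord-rows : ∀ n P → readingWord n P ≡ concat (applyUpTo (λ i → rowWord n P (n ∸ i)) n)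
readingWord-rows n P = cong concat (begin
  map row (reverse (range 1 n))     ≡⟨ cong (map row) (reverse-range1 n) ⟩
  map row (applyUpTo (n ∸_) n)      ≡⟨ map-applyUpTo (n ∸_) row n ⟩
  applyUpTo (row ∘ (n ∸_)) n        ≡⟨ applyUpTo-cong n (λ {i} _ → cong concat (map-range1 _ n)) ⟩
  applyUpTo (λ i → rowWord n P (n ∸ i)) n ∎)
  where
  open ≡-Reasoning
  row : ℕ → List ℕ
  row r = concat (map (λ c → if entry P r c then (r + c ∸ 1) ∷ [] else []) (range 1 n))

-- Row suc N - i of the pipe dream: the letters j with b i j = 1, in increasing order.
blockWord : (N : ℕ) → TriArray (suc N) → ℕ → List ℕ
blockWord N b i = select (λ x → pipeDreamCell N b (suc N ∸ i) (suc x)) ((suc N ∸ i) +_) (suc N)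

readingWord-toPipeDream : ∀ N b → readingWord (suc N) (toPipeDream N b) ≡ concat (applyUpTo (blockWord N b) (suc N))
readingWord-toPipeDream N b =
  trans (readingWord-rows (suc N) (toPipeDream N b)) (cong concat (applyUpTo-cong (suc N) rowIsBlock))
  where
  rowIsBlock : ∀ {i} → i < suc N → rowWord (suc N) (toPipeDream N b) (suc N ∸ i) ≡ blockWord N b i
  rowIsBlock {i} i<n = select-cong (suc N) cross (λ {x} _ → cong (_∸ 1) (+-suc (suc N ∸ i) x))
    where
    r≡ : suc N ∸ i ≡ suc (N ∸ i)
    r≡ = +-∸-assoc 1 (≤-pred i<n)
    cross : ∀ {x} → x < suc N → entry (toPipeDream N b) (suc N ∸ i) (suc x) ≡ pipeDreamCell N b (suc N ∸ i) (suc x)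
    cross {x} x<n rewrite r≡ = entry-matrix (pipeDreamCell N b) (s≤s (m∸n≤m N i)) x<n

occ-blockWord : ∀ N b → TriShaped N b → ∀ {i m} → i < suc N → m ≤ N → occ m (blockWord N b i) ≡ b2n (entry b i m)
occ-blockWord N b shaped {i} {m} i<n m≤N with suc N ∸ i ≤? m
... | yes r≤m = trans (occ-select-hit m (λ x → pipeDreamCell N b r (suc x)) (r +_) (suc N) (s≤s (≤-trans (m∸n≤m m r) m≤N)) (m+[n∸m]≡n r≤m)
                        (λ r+x≡m → +-cancelˡ-≡ r _ _ (trans r+x≡m (sym (m+[n∸m]≡n r≤m)))))
                      (cong b2n (pipeDreamCell-corr b (corresponding r+i (trans (+-suc r (m ∸ r)) (cong suc (m+[n∸m]≡n r≤m)))) m≤N))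
  where
  r : ℕ
  r = suc N ∸ i
  r+i : r + i ≡ suc N
  r+i = m∸n+n≡m (<⇒≤ i<n)
... | no r≰m = trans (occ-select-miss m (λ x → pipeDreamCell N b r (suc x)) (r +_) (suc N) (λ x r+x≡m → r≰m (subst (r ≤_) r+x≡m (m≤m+n r x))))
                     (cong b2n (sym (shaped i m (≤-pred i+m<n))))
  where
  r : ℕ
  r = suc N ∸ i
  i+m<n : i + m < suc N
  i+m<n = begin-strict
    i + m   <⟨ +-monoʳ-< i (≰⇒> r≰m) ⟩
    i + r   ≡⟨ +-comm i r ⟩
    r + i   ≡⟨ m∸n+n≡m (<⇒≤ i<n) ⟩
    suc N   ∎
    where open ≤-Reasoning

colCount : ∀ {k m} → Vec (Vec Bool k) m → ℕ → ℕ → ℕ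
colCount b t j = sumUpTo (λ i → b2n (entry b i j)) t

occ-blocks : ∀ N b → TriShaped N b → ∀ {t m} → t ≤ suc N → m ≤ N →
  occ m (concat (applyUpTo (blockWord N b) t)) ≡ colCount b t m
occ-blocks N b shaped {t} t≤n m≤N =
  trans (occ-concat _ (blockWord N b) t) (sumUpTo-cong t λ i<t → occ-blockWord N b shaped (<-≤-trans i<t t≤n) m≤N)

-- Pseudo-Yamanouchi reading words and the TSSCPP inequalities

PseudoYamanouchi : ℕ → List ℕ → Set
PseudoYamanouchi N a = ∀ {m} → 1 ≤ m → m < N → ∀ k → PYAt m (take k a)

take-by-length : ∀ (Q : List ℕ → Set) a → Q [] → (∀ {k} → k < length a → Q (take (suc k) a)) → ∀ k → Q (take k a)
take-by-length Q [] Q[] _ k = subst Q (sym (take-[] k)) Q[]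
take-by-length Q (x ∷ a) Q[] _ zero = Q[]
take-by-length Q (x ∷ a) Q[] Qtake (suc k) with k <? length (x ∷ a)
... | yes k<ℓ = Qtake k<ℓ
... | no k≮ℓ = subst Q (trans (take-all _ (x ∷ a) ≤-refl) (sym (take-all (suc k) (x ∷ a) (m≤n⇒m≤1+n (≮⇒≥ k≮ℓ)))))
                       (Qtake (n<1+n (length a)))

isPseudoYamanouchiWord⇒PseudoYamanouchi : ∀ N a → T (isPseudoYamanouchiWord (suc N) a) → PseudoYamanouchi N a
isPseudoYamanouchiWord⇒PseudoYamanouchi (suc N) a ok {suc j} _ (s≤s j<N) =
  take-by-length (PYAt (suc j)) a z≤n λ k<ℓ → ≤ᵇ⇒≤ _ _ (all-range1⁺ _ N (all-range1⁺ _ (length a) ok k<ℓ) j<N)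

PseudoYamanouchi⇒isPseudoYamanouchiWord : ∀ N a → PseudoYamanouchi N a → T (isPseudoYamanouchiWord (suc N) a)
PseudoYamanouchi⇒isPseudoYamanouchiWord zero a _ = all-range1⁻ _ (length a) λ _ → _
PseudoYamanouchi⇒isPseudoYamanouchiWord (suc N) a py =
  all-range1⁻ _ (length a) λ {k} _ → all-range1⁻ _ N λ j<N → ≤⇒≤ᵇ (py (s≤s z≤n) (s≤s j<N) (suc k))

ColumnBallot : (N : ℕ) → TriArray (suc N) → Set
ColumnBallot N b = ∀ {t m} → t ≤ suc N → 1 ≤ m → m < N → colCount b t (suc m) ≤ suc (colCount b t m)

module _ (N : ℕ) (b : TriArray (suc N)) (shaped : TriShaped N b) where

  private
    blocks : List (List ℕ)
    blocks = applyUpTo (blockWord N b) (suc N)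

    blocks-increasing : All (AllPairs _<_) blocks
    blocks-increasing = applyUpTo⁺₂ (blockWord N b) (suc N) λ i → select-increasing (λ x → pipeDreamCell N b (suc N ∸ i) (suc x)) _ (suc N) (+-monoʳ-< (suc N ∸ i))

    take-blocks : ∀ t → take t blocks ≡ applyUpTo (blockWord N b) (t ⊓ suc N)
    take-blocks t = take-applyUpTo (blockWord N b) t (suc N)

    PYAt⇔ballot : ∀ {t m} → t ≤ suc N → m < N →
      PYAt m (concat (applyUpTo (blockWord N b) t)) ⇔ (colCount b t (suc m) ≤ suc (colCount b t m))
    PYAt⇔ballot {t} t≤n m<N = mk⇔ (subst₂ (λ x y → x ≤ suc y) (counts m<N) (counts (<⇒≤ m<N)))
                              (subst₂ (λ x y → x ≤ suc y) (sym (counts m<N)) (sym (counts (<⇒≤ m<N))))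
      where
      counts : ∀ {j} → j ≤ N → occ j (concat (applyUpTo (blockWord N b) t)) ≡ colCount b t j
      counts = occ-blocks N b shaped t≤n

  ColumnBallot⇒PseudoYamanouchi : ColumnBallot N b → PseudoYamanouchi N (concat blocks)
  ColumnBallot⇒PseudoYamanouchi ballot {m} 1≤m m<N = blockPY⇒prefixPY m [] blocks blocks-increasing atBlocks
    where
    atBlocks : ∀ t → PYAt m (concat (take t blocks))
    atBlocks t rewrite take-blocks t =
      Equivalence.from (PYAt⇔ballot (m⊓n≤n t (suc N)) m<N) (ballot (m⊓n≤n t (suc N)) 1≤m m<N)

  PseudoYamanouchi⇒ColumnBallot : PseudoYamanouchi N (concat blocks) → ColumnBallot N b
  PseudoYamanouchi⇒ColumnBallot py {t} {m} t≤n 1≤m m<N = Equivalence.to (PYAt⇔ballot t≤n m<N) atBlock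
    where
    atBlock : PYAt m (concat (applyUpTo (blockWord N b) t))
    atBlock = subst (PYAt m ∘ concat) (trans (take-blocks t) (cong (applyUpTo _) (m≤n⇒m⊓n≡m t≤n)))
                    (prefixPY⇒blockPY m blocks (py 1≤m m<N) t)

sum-column-range : ∀ N b → TriShaped N b → ∀ {a c i} → a ≤ suc i → a + c ≤ suc N →
  sum (map (λ k → b2n (entry b k c)) (range a i)) ≡ colCount b (suc i) c
sum-column-range N b shaped {a} {c} {i} a≤ above =
  trans (sum-map-range _ a i) (sumUpTo-dropZeros (λ k → b2n (entry b k c)) a≤ λ k<a → cong b2n (shaped _ c (≤-pred (≤-trans (+-monoˡ-≤ c k<a) above))))

TriangleInequality : (N : ℕ) → TriArray (suc N) → Set
TriangleInequality N b = ∀ {x y} → x < N → y < x → colCount b (suc (suc x)) (N ∸ y) ≤ suc (colCount b (suc (suc x)) (N ∸ y ∸ 1))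

module _ (N : ℕ) (b : TriArray (suc N)) (shaped : TriShaped N b) where

  private
    left : ∀ {x y} → x < N → y < x →
      sum (map (λ k → b2n (entry b k (N ∸ y))) (range (suc y) (suc x))) ≡ colCount b (suc (suc x)) (N ∸ y)
    left x<N y<x = sum-column-range N b shaped (≤-trans y<x (m≤n⇒m≤1+n (n≤1+n _))) (s≤s (≤-reflexive (m+[n∸m]≡n (<⇒≤ (<-trans y<x x<N)))))

    right : ∀ {x y} → x < N → y < x →
      sum (map (λ k → b2n (entry b k (N ∸ y ∸ 1))) (range (suc (suc y)) (suc x))) ≡ colCount b (suc (suc x)) (N ∸ y ∸ 1)
    right {x} {y} x<N y<x = sum-column-range N b shaped (s≤s (m≤n⇒m≤1+n y<x)) (s≤s (≤-reflexive (begin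
      suc y + (N ∸ y ∸ 1)   ≡⟨ cong (suc y +_) (trans (∸-+-assoc N y 1) (cong (N ∸_) (+-comm y 1))) ⟩
      suc y + (N ∸ suc y)   ≡⟨ m+[n∸m]≡n (<-≤-trans y<x (<⇒≤ x<N)) ⟩
      N                     ∎)))
      where open ≡-Reasoning

  triIneqOK⇒TriangleInequality : T (triIneqOK (suc N) b) → TriangleInequality N b
  triIneqOK⇒TriangleInequality ok x<N y<x =
    subst₂ (λ l r → l ≤ suc r) (left x<N y<x) (right x<N y<x) (≤ᵇ⇒≤ _ _ (all-range1⁺ _ _ (all-range1⁺ _ N ok x<N) y<x))

  TriangleInequality⇒triIneqOK : TriangleInequality N b → T (triIneqOK (suc N) b)
  TriangleInequality⇒triIneqOK ineq = all-range1⁻ _ N λ {x} x<N → all-range1⁻ _ x λ y<x →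
    ≤⇒≤ᵇ (subst₂ (λ l r → l ≤ suc r) (sym (left x<N y<x)) (sym (right x<N y<x)) (ineq x<N y<x))

b2n≤1 : ∀ c → b2n c ≤ 1
b2n≤1 true = ≤-refl
b2n≤1 false = z≤n

colCount-top≤1 : ∀ N b → TriShaped N b → ∀ {t j} → t + j ≤ suc N → colCount b (suc t) j ≤ 1
colCount-top≤1 N b shaped {t} {j} t+j≤n = begin
  colCount b (suc t) j                  ≡⟨ sumUpTo-suc _ t ⟩
  colCount b t j + b2n (entry b t j)    ≡⟨ cong (_+ b2n (entry b t j)) (sumUpTo-zero _ t λ k<t → cong b2n (shaped _ j (≤-pred (≤-trans (+-monoˡ-≤ j k<t) t+j≤n)))) ⟩
  b2n (entry b t j)                     ≤⟨ b2n≤1 _ ⟩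
  1                                     ∎
  where open ≤-Reasoning

module _ (N : ℕ) (b : TriArray (suc N)) (shaped : TriShaped N b) where

  TriangleInequality⇒ColumnBallot : TriangleInequality N b → ColumnBallot N b
  TriangleInequality⇒ColumnBallot ineq {zero} _ _ _ = z≤n
  TriangleInequality⇒ColumnBallot ineq {suc t} {m} t<n 1≤m m<N with suc (N ∸ suc m) <? t
  ... | no t≤ = ≤-trans (colCount-top≤1 N b shaped (≤-trans (+-monoˡ-≤ (suc m) (≮⇒≥ t≤)) top)) (s≤s z≤n)
    where
    top : suc (N ∸ suc m) + suc m ≤ suc N
    top = s≤s (≤-reflexive (m∸n+n≡m m<N))
  ... | yes t> with t | t>
  ...   | suc x | s≤s y<x =
    subst₂ (λ j j′ → colCount b (suc (suc x)) j ≤ suc (colCount b (suc (suc x)) j′)) column (cong (_∸ 1) column) (ineq (≤-pred t<n) y<x)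
    where
    column : N ∸ (N ∸ suc m) ≡ suc m
    column = m∸[m∸n]≡n m<N

  ColumnBallot⇒TriangleInequality : ColumnBallot N b → TriangleInequality N b
  ColumnBallot⇒TriangleInequality ballot {x} {y} x<N y<x =
    subst₂ (λ j j′ → colCount b (suc (suc x)) j ≤ suc (colCount b (suc (suc x)) j′)) (sym column) (sym (cong (_∸ 1) column))
      (ballot (s≤s x<N) (m<n⇒0<n∸m sy<N) (∸-monoʳ-< z<s (<⇒≤ sy<N)))
    where
    sy<N : suc y < N
    sy<N = ≤-<-trans y<x x<N
    column : N ∸ y ≡ suc (N ∸ suc y)
    column = +-∸-assoc 1 (<⇒≤ sy<N)

-- Weights and the bijection

rowSum-toPipeDream : ∀ N b → TriShaped N b → ∀ {u} → u < suc N →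
  sum (map (λ c → b2n (entry (toPipeDream N b) (suc u) c)) (range 1 (suc N))) ≡ sum (map (λ j → b2n (entry b (N ∸ u) j)) (range 1 N))
rowSum-toPipeDream N b shaped {u} u<n = begin
  sum (map (λ c → b2n (entry (toPipeDream N b) (suc u) c)) (range 1 (suc N)))
    ≡⟨ cong sum (map-range1 _ (suc N)) ⟩
  sumUpTo (λ x → b2n (entry (toPipeDream N b) (suc u) (suc x))) (suc N)
    ≡⟨ sumUpTo-cong (suc N) (λ x<n → cong b2n (entry-matrix (pipeDreamCell N b) u<n x<n)) ⟩
  sumUpTo cell (suc N)
    ≡⟨ cong (sumUpTo cell) (sym i+su) ⟩
  sumUpTo cell (i + suc u)
    ≡⟨ sumUpTo-+ cell i (suc u) ⟩
  sumUpTo cell i + sumUpTo (λ z → cell (i + z)) (suc u)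
    ≡⟨ cong (sumUpTo cell i +_) (sumUpTo-zero _ (suc u) λ {z} _ → cong b2n (pipeDreamCell-outside b (suc u) (suc (i + z)) beyond)) ⟩
  sumUpTo cell i + 0
    ≡⟨ +-identityʳ _ ⟩
  sumUpTo cell i
    ≡⟨ sumUpTo-cong i (λ x<i → cong b2n (pipeDreamCell-corr b (corresponding (cong suc u+i) (cong suc (+-suc u _))) (in-row x<i))) ⟩
  sumUpTo (λ z → b2n (entry b i (suc (u + z)))) (N ∸ u)
    ≡⟨ sumUpTo-dropZeros (λ y → b2n (entry b i (suc y))) (≤-pred u<n) (λ {y} y<u → cong b2n (shaped i (suc y) (i+y<N y<u))) ⟩
  sumUpTo (λ y → b2n (entry b i (suc y))) N
    ≡⟨ cong sum (map-range1 _ N) ⟨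
  sum (map (λ j → b2n (entry b i j)) (range 1 N))
    ∎
  where
  open ≡-Reasoning
  i : ℕ
  i = N ∸ u
  cell : ℕ → ℕ
  cell x = b2n (pipeDreamCell N b (suc u) (suc x))
  u+i : u + i ≡ N
  u+i = m+[n∸m]≡n (≤-pred u<n)
  i+su : i + suc u ≡ suc N
  i+su = trans (+-suc i u) (cong suc (trans (+-comm i u) u+i))
  beyond : ∀ {z} → ¬ suc u + suc (i + z) ≤ suc N
  beyond {z} = <⇒≱ (s≤s (subst (suc N ≤_) (sym (trans (+-suc u (i + z)) (cong suc (trans (sym (+-assoc u i z)) (cong (_+ z) u+i)))))
                            (s≤s (m≤m+n N z))))
  in-row : ∀ {x} → x < i → suc (u + x) ≤ N
  in-row {x} x<i = subst (_≤ N) (+-suc u x) (subst (u + suc x ≤_) u+i (+-monoʳ-≤ u x<i))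
  i+y<N : ∀ {y} → y < u → i + suc y ≤ N
  i+y<N {y} y<u = subst (i + suc y ≤_) (trans (+-comm i u) u+i) (+-monoʳ-≤ i y<u)

pdWeight-toPipeDream : ∀ N b → TriShaped N b → pdWeight (suc N) (toPipeDream N b) ≡ triWeight (suc N) b
pdWeight-toPipeDream N b shaped = tabulate-cong λ r → rowSum-toPipeDream N b shaped (toℕ<n r)

PYReadingWord : (N : ℕ) → PDArray (suc N) → Set
PYReadingWord N P = T (isPseudoYamanouchiWord (suc N) (readingWord (suc N) P))

triIneqOK⇔PYReadingWord : ∀ N b → TriShaped N b → T (triIneqOK (suc N) b) ⇔ PYReadingWord N (toPipeDream N b)
triIneqOK⇔PYReadingWord N b shaped = mk⇔
  (λ ok → subst (T ∘ isPseudoYamanouchiWord (suc N)) (sym (readingWord-toPipeDream N b))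
    (PseudoYamanouchi⇒isPseudoYamanouchiWord N _ (ColumnBallot⇒PseudoYamanouchi N b shaped
      (TriangleInequality⇒ColumnBallot N b shaped (triIneqOK⇒TriangleInequality N b shaped ok)))))
  (λ py → TriangleInequality⇒triIneqOK N b shaped (ColumnBallot⇒TriangleInequality N b shaped
    (PseudoYamanouchi⇒ColumnBallot N b shaped (isPseudoYamanouchiWord⇒PseudoYamanouchi N _
      (subst (T ∘ isPseudoYamanouchiWord (suc N)) (readingWord-toPipeDream N b) py)))))

Σ-T-≡ : ∀ {A : Set} {f : A → Bool} {x y : Σ A (T ∘ f)} → proj₁ x ≡ proj₁ y → x ≡ y
Σ-T-≡ {x = a , p} {y = .a , q} refl = cong (a ,_) (T-irrelevant p q)

module Correspondence (N : ℕ) where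

  triShaped : (t : TSSCPPTri (suc N)) → TriShaped N (proj₁ t)
  triShaped (b , ok) = triShapeOK⇒TriShaped N b (proj₁ (Equivalence.to T-∧ ok))

  pdShaped : (P : PYPipeDream (suc N)) → PDShaped N (proj₁ P)
  pdShaped (P , ok) = pdShapeOK⇒PDShaped N P (proj₁ (Equivalence.to T-∧ ok))

  toPY : TSSCPPTri (suc N) → PYPipeDream (suc N)
  toPY t@(b , ok) = toPipeDream N b , Equivalence.from T-∧ (shapeOK , readingOK)
    where
    shapeOK : T (pdShapeOK (suc N) (toPipeDream N b))
    shapeOK = PDShaped⇒pdShapeOK N (toPipeDream N b) (toPipeDream-shaped N b)
    readingOK : PYReadingWord N (toPipeDream N b)
    readingOK = Equivalence.to (triIneqOK⇔PYReadingWord N b (triShaped t)) (proj₂ (Equivalence.to T-∧ ok))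

  fromPY : PYPipeDream (suc N) → TSSCPPTri (suc N)
  fromPY P@(Q , ok) = toTriangle N Q , Equivalence.from T-∧ (shapeOK , ineqOK)
    where
    shapeOK : T (triShapeOK (suc N) (toTriangle N Q))
    shapeOK = TriShaped⇒triShapeOK N (toTriangle N Q) (toTriangle-shaped N Q)
    readingOK : PYReadingWord N (toPipeDream N (toTriangle N Q))
    readingOK = subst (PYReadingWord N) (sym (toPipeDream∘toTriangle N Q (pdShaped P))) (proj₂ (Equivalence.to T-∧ ok))
    ineqOK : T (triIneqOK (suc N) (toTriangle N Q))
    ineqOK = Equivalence.from (triIneqOK⇔PYReadingWord N (toTriangle N Q) (toTriangle-shaped N Q)) readingOK

  toPY∘fromPY : ∀ P → toPY (fromPY P) ≡ P
  toPY∘fromPY P = Σ-T-≡ (toPipeDream∘toTriangle N (proj₁ P) (pdShaped P))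

  fromPY∘toPY : ∀ t → fromPY (toPY t) ≡ t
  fromPY∘toPY t = Σ-T-≡ (toTriangle∘toPipeDream N (proj₁ t) (triShaped t))

  toPY-weight : ∀ t → pdWeight (suc N) (proj₁ (toPY t)) ≡ triWeight (suc N) (proj₁ t)
  toPY-weight t = pdWeight-toPipeDream N (proj₁ t) (triShaped t)

theorem3p3 : (n : ℕ) → 1 ≤ n →
    Σ (TSSCPPTri n ⤖ PYPipeDream n)
      (λ f → (t : TSSCPPTri n) →
        pdWeight n (proj₁ (Bijection.to f t)) ≡ triWeight n (proj₁ t))
theorem3p3 (suc N) _ = ↔⇒⤖ (mk↔ₛ′ toPY fromPY toPY∘fromPY fromPY∘toPY) , toPY-weight
  where open Correspondence N
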